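{- Let $q$ be a prime power, $m,t$ positive integers and $k\ge2$. Let $\mathcal{U}=(\mathcal{U}_1,\dots,\mathcal{U}_t)$ be a cutting system in $\mathbb{F}_{q^m}^k$. Then $\mathcal{U}$, regarded as a tuple of $\mathbb{F}_q$-subspaces of $\mathbb{F}_{q^{m(k-1)}}^k$ via the inclusion $\mathbb{F}_{q^m}\subseteq\mathbb{F}_{q^{m(k-1)}}$, is a sum-rank $(k-1)$-saturating system in $\mathbb{F}_{q^{m(k-1)}}^k$.
   Context: A system in $\mathbb{F}_{q^m}^k$ is a tuple $(\mathcal{U}_1,\dots,\mathcal{U}_t)$ of $\mathbb{F}_q$-subspaces of $\mathbb{F}_{q^m}^k$ whose union spans $\mathbb{F}_{q^m}^k$ over $\mathbb{F}_{q^m}$. For a field extension $\mathbb{F}_{Q}\supseteq\mathbb{F}_q$ and an $\mathbb{F}_q$-subspace $W\le\mathbb{F}_Q^k$, $L_W=\{\langle u\rangle_{\mathbb{F}_Q}:u\in W\setminus\{0\}\}\subseteq\mathrm{PG}(k-1,Q)$. The system is cutting if $L_{\mathcal{U}_1}\cup\cdots\cup L_{\mathcal{U}_t}$ is a strong blocking set of $\mathrm{PG}(k-1,q^m)$, i.e. for every hyperplane $\mathcal{H}$ of $\mathrm{PG}(k-1,q^m)$, the $\mathbb{F}_{q^m}$-span of $(L_{\mathcal{U}_1}\cup\cdots\cup L_{\mathcal{U}_t})\cap\mathcal{H}$ equals $\mathcal{H}$. A point set $\mathcal{S}$ of $\mathrm{PG}(k-1,Q)$ is $s$-saturating if every point lies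 in the $\mathbb{F}_Q$-span of some $s+1$ points of $\mathcal{S}$ and $s$ is minimal with this property; a system in $\mathbb{F}_Q^k$ is sum-rank $\rho$-saturating if the union of the linear sets (over $\mathbb{F}_Q$) of its components is $(\rho-1)$-saturating in $\mathrm{PG}(k-1,Q)$. -}

module Defs where

open import Level using (0ℓ)
open import Data.Nat using (ℕ; zero; suc; _≤_; _∸_; _^_)
import Data.Nat as ℕ
open import Data.Nat.Primality using (Prime)
open import Data.Fin using (Fin; zero; suc)
open import Data.List using (List; length)
open import Data.List.Membership.Propositional using (_∈_)
open import Data.List.Relation.Unary.All using (All)
open import Data.List.Relation.Unary.Unique.Propositional using (Unique)
open import Data.Product using (Σ; ∃; _×_; _,_)
open import Data.Unit using (⊤)
open import Relation.Nullary using (¬_)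
open import Relation.Binary.PropositionalEquality using (_≡_; _≢_)
open import Algebra.Core using (Op₁; Op₂)
import Algebra.Structures as AS

IsPrimePower : ℕ → Set
IsPrimePower q = ∃ λ p → ∃ λ e → Prime p × 1 ≤ e × q ≡ p ^ e

record Field : Set₁ where
  infixl 6 _+_
  infixl 7 _*_
  field
    Carrier : Set
    _+_ _*_ : Op₂ Carrier
    -_      : Op₁ Carrier
    0# 1#   : Carrier
    isCommutativeRing : AS.IsCommutativeRing {A = Carrier} _≡_ _+_ _*_ -_ 0# 1#
    0≢1     : 0# ≢ 1#
    inverse : ∀ x → x ≢ 0# → ∃ λ y → x * y ≡ 1#

module _ (F : Field) where
  open Field F

  Pred : Set₁
  Pred = Carrier → Set

  record IsSubfield (P : Pred) : Set where
    field
      0∈ : P 0#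
      1∈ : P 1#
      +∈ : ∀ {x y} → P x → P y → P (x + y)
      *∈ : ∀ {x y} → P x → P y → P (x * y)
      -∈ : ∀ {x} → P x → P (- x)
      ⁻¹∈ : ∀ {x y} → P x → x * y ≡ 1# → P y

  HasSize : Pred → ℕ → Set
  HasSize P n = ∃ λ (xs : List Carrier) →
    length xs ≡ n × Unique xs × All P xs × (∀ x → P x → x ∈ xs)

  Vect : ℕ → Set
  Vect k = Fin k → Carrier

  _≈ᵥ_ : ∀ {k} → Vect k → Vect k → Set
  u ≈ᵥ v = ∀ i → u i ≡ v i

  0ᵥ : ∀ {k} → Vect k
  0ᵥ _ = 0#

  _⊕_ : ∀ {k} → Vect k → Vect k → Vect k
  (u ⊕ v) i = u i + v i

  _·_ : ∀ {k} → Carrier → Vect k → Vect k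
  (a · u) i = a * u i

  sumF : ∀ {n} → (Fin n → Carrier) → Carrier
  sumF {zero} f = 0#
  sumF {suc n} f = f zero + sumF (λ j → f (suc j))

  dot : ∀ {k} → Vect k → Vect k → Carrier
  dot h v = sumF (λ i → h i * v i)

  linComb : ∀ {k n} → (Fin n → Carrier) → (Fin n → Vect k) → Vect k
  linComb {n = zero} a u = 0ᵥ
  linComb {n = suc n} a u = (a zero · u zero) ⊕ linComb (λ j → a (suc j)) (λ j → u (suc j))

  InSpan : ∀ {k} → Pred → (Vect k → Set) → Vect k → Set
  InSpan K S v = ∃ λ n → ∃ λ (a : Fin n → Carrier) → ∃ λ (u : Fin n → Vect _) →
    (∀ j → K (a j)) × (∀ j → S (u j)) × (linComb a u ≈ᵥ v)

  -- all coordinates lie in E, i.e. the vector belongs to E^k ⊆ F^k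
  InSub : ∀ {k} → Pred → Vect k → Set
  InSub E v = ∀ i → E (v i)

  record IsSubspaceOver (K E : Pred) {k} (U : Vect k → Set) : Set where
    field
      respects : ∀ {u v} → u ≈ᵥ v → U u → U v
      inE : ∀ {u} → U u → InSub E u
      0∈ : U 0ᵥ
      +∈ : ∀ {u v} → U u → U v → U (u ⊕ v)
      ·∈ : ∀ {a u} → K a → U u → U (a · u)

  Union : ∀ {k t} → (Fin t → Vect k → Set) → Vect k → Set
  Union U u = ∃ λ i → U i u

  record IsSystem (K E : Pred) {k t} (U : Fin t → Vect k → Set) : Set where
    field
      subspaces : ∀ i → IsSubspaceOver K E (U i)
      spans : ∀ v → InSub E v → InSpan E (Union U) v

  -- Points of L_{U_1} ∪ … ∪ L_{U_t} over E are ⟨u⟩_E for nonzero u in the union.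
  -- Hyperplanes of PG(k-1,E) are the kernels {v ∈ E^k : h·v = 0}, h ∈ E^k nonzero.
  -- The E-span of the points of the union lying in H is the E-span of
  -- {u ∈ ∪U_i : u ≠ 0, h·u = 0}.
  IsCutting : (K E : Pred) {k t : ℕ} (U : Fin t → Vect k → Set) → Set
  IsCutting K E {k} U =
    IsSystem K E U ×
    (∀ (h : Vect k) → InSub E h → ¬ (h ≈ᵥ 0ᵥ) →
      ∀ v → InSub E v → dot h v ≡ 0# →
        InSpan E (λ u → Union U u × ¬ (u ≈ᵥ 0ᵥ) × dot h u ≡ 0#) v)

  -- Every point ⟨v⟩_F of PG(k-1,F) lies in the F-span of at most n points
  -- ⟨u_j⟩_F of the linear set L_{U_1} ∪ … ∪ L_{U_t} (u_j ∈ ∪U_i nonzero).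
  CoveredBy : {k t : ℕ} (U : Fin t → Vect k → Set) → ℕ → Set
  CoveredBy {k} U n = ∀ (v : Vect k) → ¬ (v ≈ᵥ 0ᵥ) →
    ∃ λ r → r ≤ n × ∃ λ (a : Fin r → Carrier) → ∃ λ (u : Fin r → Vect k) →
      (∀ j → Union U (u j) × ¬ (u j ≈ᵥ 0ᵥ)) × (linComb a u ≈ᵥ v)

  -- The point set is s-saturating in PG(k-1,F): every point is in the span of
  -- some s+1 points, and s is minimal with this property.
  IsSaturatingSet : {k t : ℕ} (U : Fin t → Vect k → Set) → ℕ → Set
  IsSaturatingSet U s = CoveredBy U (suc s) × ¬ CoveredBy U s

  -- sum-rank ρ-saturating system in F^k (ρ ≥ 1): the union of the F-linear
  -- sets is (ρ-1)-saturating.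
  -- K is the subfield F_q; the U_i are K-subspaces of F^k.
  IsSumRankSaturating : (K : Pred) {k t : ℕ} (U : Fin t → Vect k → Set) → ℕ → Set
  IsSumRankSaturating K U ρ = IsSystem K (λ _ → ⊤) U × IsSaturatingSet U (ρ ∸ 1)

-- Write E = F_{q^m} ⊆ L = F_{q^{m(k-1)}}, so that |E|^(k-2) < |L| < |E|^k.
--
-- Every vector v of L^k is a combination of at most k-1 vectors of the system: as |E|^k > |L|,
-- two distinct h, h' ∈ E^k have h·v = h'·v, so v lies on the hyperplane (h - h')^⊥. By the
-- cutting property the nonzero vectors of the system on this hyperplane span its E-rational part
-- over E, hence span the whole hyperplane over L. They lie in E^k ∩ (h - h')^⊥, of E-dimension
-- k-1, so any k of them are dependent and a combination can be pruned to k-1 vectors.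
--
-- Not every point is covered by k-2 of them: as |E|^(k-2) < |L|, there are b_1, …, b_(k-1) ∈ L
-- linearly independent over E. If (1, b) were an L-combination of r ≤ k-2 vectors of E^k, the
-- k-1 rows formed by their last k-1 coordinates would satisfy an E-linear relation in E^r, and
-- the same relation would annihilate b.

module Submission where

open import Defs
open import Level using (0ℓ)
open import Data.Nat using (ℕ; zero; suc; z≤n; s≤s; nonTrivial⇒n>1)
open import Data.Nat.Primality using (prime⇒nonTrivial)
import Data.Nat as ℕ
import Data.Nat.Properties as ℕ
open import Data.Fin using (Fin; zero; suc; punchIn; punchOut; splitAt; combine; finToFun; funToFin)
import Data.Fin.Properties as Fin
import Data.Vec.Functional as Vector
open import Data.Vec.Functional using (Vector; tail; insertAt; removeAt; _++_)
open import Data.Vec.Functional.Properties using (insertAt-lookup; insertAt-punchIn)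
open import Data.List using (List; lookup)
open import Data.List.Relation.Unary.AllPairs using (_∷_)
open import Data.List.Relation.Unary.Unique.Propositional using (Unique)
import Data.List.Relation.Unary.All as All
import Data.List.Relation.Unary.Any as Any
import Data.List.Relation.Unary.Any.Properties as AnyProperties
open import Data.List.Membership.Propositional.Properties using (∈-lookup)
open import Data.Product using (∃; _×_; _,_; proj₁; proj₂)
open import Data.Sum using (inj₁; inj₂)
open import Data.Sum.Properties using ([,]-map)
open import Data.Unit using (⊤; tt)
open import Function using (_∘_)
open import Relation.Nullary using (¬_; ¬?; yes; no; contradiction)
open import Relation.Nullary.Decidable as Dec using (decidable-stable)
open import Relation.Binary.Definitions using (DecidableEquality)
open import Relation.Binary.PropositionalEquality using (_≡_; _≢_; refl; sym; trans; cong; cong₂; subst; module ≡-Reasoning)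
open import Algebra.Bundles using (CommutativeRing)
import Algebra.Properties.Semiring.Sum as SemiringSum
import Algebra.Properties.Ring as RingProperties
import Algebra.Properties.CommutativeSemigroup as CommutativeSemigroupProperties
import Algebra.Properties.Group as AdditiveGroupProperties

++-all : ∀ {m n} {A : Set} {P : A → Set} (f : Fin m → A) (g : Fin n → A) →
  (∀ i → P (f i)) → (∀ i → P (g i)) → ∀ i → P ((f ++ g) i)
++-all {m} f g pf pg i with splitAt m i
... | inj₁ j = pf j
... | inj₂ j = pg j

insertAt-all : ∀ {n} {A : Set} {P : A → Set} (xs : Vector A n) p {v} → P v → (∀ i → P (xs i)) →
  ∀ i → P (insertAt xs p v i)
insertAt-all xs zero pv pxs zero = pv
insertAt-all xs zero pv pxs (suc j) = pxs j
insertAt-all {suc n} xs (suc p) pv pxs zero = pxs zero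
insertAt-all {suc n} {P = P} xs (suc p) pv pxs (suc j) = insertAt-all {P = P} (tail xs) p pv (pxs ∘ suc) j

lookup-injective : ∀ {A : Set} {xs : List A} → Unique xs → ∀ i j → lookup xs i ≡ lookup xs j → i ≡ j
lookup-injective (_ ∷ _) zero zero _ = refl
lookup-injective (x∉xs ∷ _) zero (suc j) eq = contradiction eq (All.lookup x∉xs (∈-lookup j))
lookup-injective (x∉xs ∷ _) (suc i) zero eq = contradiction (sym eq) (All.lookup x∉xs (∈-lookup i))
lookup-injective (_ ∷ xs!) (suc i) (suc j) eq = cong suc (lookup-injective xs! i j eq)

record Enumeration {A : Set} (P : A → Set) (n : ℕ) : Set where
  field
    elem : Fin n → A
    elem-injective : ∀ i j → elem i ≡ elem j → i ≡ j
    elem∈ : ∀ i → P (elem i)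
    index : ∀ {x} → P x → Fin n
    elem-index : ∀ {x} (px : P x) → elem (index px) ≡ x

enumeration : ∀ (F : Field) {P : Pred F} {n} → HasSize F P n → Enumeration P n
enumeration F (xs , refl , xs! , xs⊆P , P⊆xs) = record
  { elem = lookup xs
  ; elem-injective = lookup-injective xs!
  ; elem∈ = λ i → All.lookup xs⊆P (∈-lookup i)
  ; index = λ {x} px → Any.index (P⊆xs x px)
  ; elem-index = λ {x} px → sym (AnyProperties.lookup-index (P⊆xs x px))
  }

decidableEquality : ∀ {A : Set} {n} → Enumeration {A} (λ _ → ⊤) n → DecidableEquality A
decidableEquality enum x y = Dec.map′ same-index⇒≡ (cong (λ z → index {z} tt)) (index {x} tt Fin.≟ index {y} tt)
  where
  open Enumeration enum
  same-index⇒≡ : index {x} tt ≡ index {y} tt → x ≡ y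
  same-index⇒≡ eq = trans (sym (elem-index tt)) (trans (cong elem eq) (elem-index tt))

funToFin-cong : ∀ {m n} {f g : Fin m → Fin n} → (∀ i → f i ≡ g i) → funToFin f ≡ funToFin g
funToFin-cong {zero} _ = refl
funToFin-cong {suc m} f≗g = cong₂ combine (f≗g zero) (funToFin-cong (f≗g ∘ suc))

module Tuples {A : Set} {P : A → Set} {n} (enum : Enumeration P n) where
  open Enumeration enum

  tuple : ∀ {k} → Fin (n ℕ.^ k) → Fin k → A
  tuple {k} t i = elem (finToFun {n} {k} t i)

  tuple∈ : ∀ {k} (t : Fin (n ℕ.^ k)) i → P (tuple t i)
  tuple∈ {k} t i = elem∈ (finToFun {n} {k} t i)

  tuple-complete : ∀ {k} (c : Fin k → A) → (∀ i → P (c i)) → ∃ λ t → ∀ i → tuple {k} t i ≡ c i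
  tuple-complete {k} c c∈P = funToFin (index ∘ c∈P) , λ i →
    trans (cong elem (Fin.finToFun-funToFin {k} {n} (index ∘ c∈P) i)) (elem-index (c∈P i))

  tuple-injective : ∀ {k} (t t' : Fin (n ℕ.^ k)) → (∀ i → tuple {k} t i ≡ tuple t' i) → t ≡ t'
  tuple-injective {k} t t' t≗t' = begin
    t                              ≡⟨ Fin.funToFin-finToFin {k} {n} t ⟨
    funToFin (finToFun {n} {k} t)  ≡⟨ funToFin-cong {k} {n} (λ i → elem-injective _ _ (t≗t' i)) ⟩
    funToFin (finToFun {n} {k} t') ≡⟨ Fin.funToFin-finToFin {k} {n} t' ⟩
    t'                             ∎
    where open ≡-Reasoning

module Linear (F : Field) where
  open Field F

  commutativeRing : CommutativeRing 0ℓ 0ℓ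
  commutativeRing = record { isCommutativeRing = isCommutativeRing }

  open CommutativeRing commutativeRing public
    using (+-comm; +-assoc; *-comm; *-assoc; +-identityˡ; +-identityʳ; *-identityˡ; *-identityʳ;
           distribˡ; distribʳ; zeroˡ; zeroʳ; -‿inverseʳ)
  open RingProperties (CommutativeRing.ring commutativeRing) public
    using (-‿distribˡ-*; -‿distribʳ-*; -1*x≈-x; -‿involutive)
  open SemiringSum (CommutativeRing.semiring commutativeRing) public
    using (sum; sum-cong-≗; ∑-distrib-+; ∑-comm; sum-remove; *-distribˡ-sum; *-distribʳ-sum; sum-replicate-zero)
  open CommutativeSemigroupProperties (CommutativeRing.*-commutativeSemigroup commutativeRing) public
    using (x∙yz≈y∙xz; x∙yz≈z∙yx)

  V : ℕ → Set
  V = Vect F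

  x≢0∧x*y≡0⇒y≡0 : ∀ {x y} → x ≢ 0# → x * y ≡ 0# → y ≡ 0#
  x≢0∧x*y≡0⇒y≡0 {x} {y} x≢0 xy≡0 with inverse x x≢0
  ... | x⁻¹ , xx⁻¹≡1 = begin
    y              ≡⟨ *-identityˡ y ⟨
    1# * y         ≡⟨ cong (_* y) (trans (sym xx⁻¹≡1) (*-comm x x⁻¹)) ⟩
    x⁻¹ * x * y    ≡⟨ *-assoc x⁻¹ x y ⟩
    x⁻¹ * (x * y)  ≡⟨ cong (x⁻¹ *_) xy≡0 ⟩
    x⁻¹ * 0#       ≡⟨ zeroʳ x⁻¹ ⟩
    0#             ∎
    where open ≡-Reasoning

  x*[-y*z]≡-z*[y*x] : ∀ x y z → x * (- y * z) ≡ - z * (y * x)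
  x*[-y*z]≡-z*[y*x] x y z = begin
    x * (- y * z)    ≡⟨ cong (x *_) (-‿distribˡ-* y z) ⟨
    x * - (y * z)    ≡⟨ -‿distribʳ-* x (y * z) ⟨
    - (x * (y * z))  ≡⟨ cong -_ (x∙yz≈z∙yx x y z) ⟩
    - (z * (y * x))  ≡⟨ -‿distribˡ-* z (y * x) ⟩
    - z * (y * x)    ∎
    where open ≡-Reasoning

  sumF≡sum : ∀ {n} (f : Fin n → Carrier) → sumF F f ≡ sum f
  sumF≡sum {zero} f = refl
  sumF≡sum {suc n} f = cong (f zero +_) (sumF≡sum (f ∘ suc))

  sum-zero : ∀ {n} {f : Fin n → Carrier} → (∀ i → f i ≡ 0#) → sum f ≡ 0#
  sum-zero {n} f≗0 = trans (sum-cong-≗ f≗0) (sum-replicate-zero n)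

  sum-linear : ∀ {n} (a b : Carrier) (f g : Fin n → Carrier) →
    sum (λ i → a * f i + b * g i) ≡ a * sum f + b * sum g
  sum-linear {n} a b f g = trans (∑-distrib-+ {n} _ _) (sym (cong₂ _+_ (*-distribˡ-sum {n} a f) (*-distribˡ-sum {n} b g)))

  sum-single : ∀ {n} (f : Fin (suc n) → Carrier) i → (∀ j → f (punchIn i j) ≡ 0#) → sum f ≡ f i
  sum-single f i f≡0-off-i = trans (sum-remove f) (trans (cong (f i +_) (sum-zero f≡0-off-i)) (+-identityʳ (f i)))

  sum-++ : ∀ {m n} (f : Fin m → Carrier) (g : Fin n → Carrier) → sum (f ++ g) ≡ sum f + sum g
  sum-++ {zero} f g = sym (+-identityˡ (sum g))
  sum-++ {suc m} f g = begin
    f zero + sum (tail (f ++ g))     ≡⟨ cong (f zero +_) (sum-cong-≗ (λ i → [,]-map (splitAt m i))) ⟩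
    f zero + sum (tail f ++ g)       ≡⟨ cong (f zero +_) (sum-++ (tail f) g) ⟩
    f zero + (sum (tail f) + sum g)  ≡⟨ +-assoc _ _ _ ⟨
    f zero + sum (tail f) + sum g    ∎
    where open ≡-Reasoning

  dot≡sum : ∀ {k} (h v : V k) → dot F h v ≡ sum (λ i → h i * v i)
  dot≡sum h v = sumF≡sum (λ i → h i * v i)

  dot-cong : ∀ {k} {a a' b b' : V k} → (∀ i → a i ≡ a' i) → (∀ i → b i ≡ b' i) → dot F a b ≡ dot F a' b'
  dot-cong {a = a} {a'} {b} {b'} a≗a' b≗b' = begin
    dot F a b                ≡⟨ dot≡sum a b ⟩
    sum (λ i → a i * b i)    ≡⟨ sum-cong-≗ (λ i → cong₂ _*_ (a≗a' i) (b≗b' i)) ⟩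
    sum (λ i → a' i * b' i)  ≡⟨ dot≡sum a' b' ⟨
    dot F a' b'              ∎
    where open ≡-Reasoning

  dot-*ˡ : ∀ {k} (g : Carrier) (c b : V k) → dot F (λ i → g * c i) b ≡ g * dot F c b
  dot-*ˡ {k} g c b = begin
    dot F (λ i → g * c i) b      ≡⟨ dot≡sum _ b ⟩
    sum (λ i → g * c i * b i)    ≡⟨ sum-cong-≗ (λ i → *-assoc g (c i) (b i)) ⟩
    sum (λ i → g * (c i * b i))  ≡⟨ *-distribˡ-sum {k} g _ ⟨
    g * sum (λ i → c i * b i)    ≡⟨ cong (g *_) (dot≡sum c b) ⟨
    g * dot F c b                ∎
    where open ≡-Reasoning

  dot-difference : ∀ {k} (a b v : V k) → dot F (λ i → a i + - b i) v ≡ dot F a v + - dot F b v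
  dot-difference {k} a b v = begin
    dot F (λ i → a i + - b i) v
      ≡⟨ dot≡sum _ v ⟩
    sum (λ i → (a i + - b i) * v i)
      ≡⟨ sum-cong-≗ expand ⟩
    sum (λ i → 1# * (a i * v i) + - 1# * (b i * v i))
      ≡⟨ sum-linear 1# (- 1#) (λ i → a i * v i) (λ i → b i * v i) ⟩
    1# * sum (λ i → a i * v i) + - 1# * sum (λ i → b i * v i)
      ≡⟨ cong₂ _+_ (*-identityˡ _) (-1*x≈-x _) ⟩
    sum (λ i → a i * v i) + - sum (λ i → b i * v i)
      ≡⟨ cong₂ (λ s t → s + - t) (dot≡sum a v) (dot≡sum b v) ⟨
    dot F a v + - dot F b v                                 ∎
    where
    open ≡-Reasoning
    expand : ∀ i → (a i + - b i) * v i ≡ 1# * (a i * v i) + - 1# * (b i * v i)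
    expand i = trans (distribʳ (v i) (a i) (- b i))
                     (cong₂ _+_ (sym (*-identityˡ _)) (trans (sym (-‿distribˡ-* (b i) (v i))) (sym (-1*x≈-x _))))

  linComb-coordinate : ∀ {k n} (a : Fin n → Carrier) (u : Fin n → V k) i →
    linComb F a u i ≡ sum (λ l → a l * u l i)
  linComb-coordinate {n = zero} a u i = refl
  linComb-coordinate {n = suc n} a u i = cong (a zero * u zero i +_) (linComb-coordinate (a ∘ suc) (u ∘ suc) i)

  linComb-∘ : ∀ {k k' n} (c : Fin n → Carrier) (u : Fin n → V k) (σ : Fin k' → Fin k) x →
    linComb F c (λ l → u l ∘ σ) x ≡ linComb F c u (σ x)
  linComb-∘ c u σ x = trans (linComb-coordinate c (λ l → u l ∘ σ) x) (sym (linComb-coordinate c u (σ x)))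

  linComb-+ : ∀ {k n} (a b : Fin n → Carrier) (u : Fin n → V k) x →
    linComb F (λ l → a l + b l) u x ≡ linComb F a u x + linComb F b u x
  linComb-+ {n = n} a b u x = begin
    linComb F (λ l → a l + b l) u x
      ≡⟨ linComb-coordinate _ u x ⟩
    sum (λ l → (a l + b l) * u l x)
      ≡⟨ sum-cong-≗ (λ l → distribʳ (u l x) (a l) (b l)) ⟩
    sum (λ l → a l * u l x + b l * u l x)
      ≡⟨ ∑-distrib-+ {n} _ _ ⟩
    sum (λ l → a l * u l x) + sum (λ l → b l * u l x)
      ≡⟨ cong₂ _+_ (linComb-coordinate a u x) (linComb-coordinate b u x) ⟨
    linComb F a u x + linComb F b u x              ∎
    where open ≡-Reasoning

  linComb-* : ∀ {k n} (g : Carrier) (a : Fin n → Carrier) (u : Fin n → V k) x →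
    linComb F (λ l → g * a l) u x ≡ g * linComb F a u x
  linComb-* {n = n} g a u x = begin
    linComb F (λ l → g * a l) u x  ≡⟨ linComb-coordinate _ u x ⟩
    sum (λ l → g * a l * u l x)    ≡⟨ sum-cong-≗ (λ l → *-assoc g (a l) (u l x)) ⟩
    sum (λ l → g * (a l * u l x))  ≡⟨ *-distribˡ-sum {n} g _ ⟨
    g * sum (λ l → a l * u l x)    ≡⟨ cong (g *_) (linComb-coordinate a u x) ⟨
    g * linComb F a u x            ∎
    where open ≡-Reasoning

  dot-linComb : ∀ {k n} (h : V k) (c : Fin n → Carrier) (u : Fin n → V k) →
    dot F h (linComb F c u) ≡ sum (λ l → c l * dot F h (u l))
  dot-linComb {k} {n} h c u = begin
    dot F h (linComb F c u)
      ≡⟨ dot≡sum h _ ⟩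
    sum (λ x → h x * linComb F c u x)
      ≡⟨ sum-cong-≗ (λ x → cong (h x *_) (linComb-coordinate c u x)) ⟩
    sum (λ x → h x * sum (λ l → c l * u l x))
      ≡⟨ sum-cong-≗ (λ x → *-distribˡ-sum {n} (h x) _) ⟩
    sum (λ x → sum (λ l → h x * (c l * u l x)))
      ≡⟨ sum-cong-≗ (λ x → sum-cong-≗ (λ l → x∙yz≈y∙xz (h x) (c l) (u l x))) ⟩
    sum (λ x → sum (λ l → c l * (h x * u l x)))
      ≡⟨ ∑-comm {k} {n} _ ⟩
    sum (λ l → sum (λ x → c l * (h x * u l x)))
      ≡⟨ sum-cong-≗ (λ l → *-distribˡ-sum {k} (c l) _) ⟨
    sum (λ l → c l * sum (λ x → h x * u l x))
      ≡⟨ sum-cong-≗ (λ l → cong (c l *_) (dot≡sum h (u l))) ⟨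
    sum (λ l → c l * dot F h (u l))                  ∎
    where open ≡-Reasoning

  linComb-++ : ∀ {k m n} (a : Fin m → Carrier) (u : Fin m → V k) (b : Fin n → Carrier) (w : Fin n → V k) x →
    linComb F (a ++ b) (u ++ w) x ≡ linComb F a u x + linComb F b w x
  linComb-++ {m = m} {n} a u b w x = begin
    linComb F (a ++ b) (u ++ w) x
      ≡⟨ linComb-coordinate (a ++ b) (u ++ w) x ⟩
    sum (λ l → (a ++ b) l * (u ++ w) l x)
      ≡⟨ sum-cong-≗ split ⟩
    sum ((λ l → a l * u l x) ++ (λ l → b l * w l x))
      ≡⟨ sum-++ (λ l → a l * u l x) (λ l → b l * w l x) ⟩
    sum (λ l → a l * u l x) + sum (λ l → b l * w l x)
      ≡⟨ cong₂ _+_ (linComb-coordinate a u x) (linComb-coordinate b w x) ⟨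
    linComb F a u x + linComb F b w x                ∎
    where
    open ≡-Reasoning
    split : ∀ l → (a ++ b) l * (u ++ w) l x ≡ ((λ l → a l * u l x) ++ (λ l → b l * w l x)) l
    split l with splitAt m l
    ... | inj₁ _ = refl
    ... | inj₂ _ = refl

  linComb-removeAt : ∀ {k N} (a : Fin (suc N) → Carrier) (u : Fin (suc N) → V k) j → a j ≡ 0# → ∀ x →
    linComb F (removeAt a j) (removeAt u j) x ≡ linComb F a u x
  linComb-removeAt a u j aj≡0 x = begin
    linComb F (removeAt a j) (removeAt u j) x
      ≡⟨ linComb-coordinate (removeAt a j) (removeAt u j) x ⟩
    sum (removeAt t j)
      ≡⟨ +-identityˡ _ ⟨
    0# + sum (removeAt t j)
      ≡⟨ cong (_+ sum (removeAt t j)) (trans (cong (_* u j x) aj≡0) (zeroˡ (u j x))) ⟨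
    t j + sum (removeAt t j)
      ≡⟨ sum-remove t ⟨
    sum t
      ≡⟨ linComb-coordinate a u x ⟨
    linComb F a u x                            ∎
    where
    open ≡-Reasoning
    t : Fin _ → Carrier
    t l = a l * u l x

  removeAt-redundant : ∀ {k N} (c a : Fin (suc N) → Carrier) (u : Fin (suc N) → V k) (v : V k) j →
    c j ≢ 0# → (∀ x → linComb F c u x ≡ 0#) → (∀ x → linComb F a u x ≡ v x) →
    ∃ λ a' → ∀ x → linComb F a' (removeAt u j) x ≡ v x
  removeAt-redundant c a u v j cj≢0 cu≡0 au≡v with inverse (c j) cj≢0
  ... | γ , cjγ≡1 = removeAt a' j , λ x → trans (linComb-removeAt a' u j a'j≡0 x) (a'u≡v x)
    where
    g : Carrier
    g = - (a j * γ)
    a' : Fin _ → Carrier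
    a' l = a l + g * c l
    a'u≡v : ∀ x → linComb F a' u x ≡ v x
    a'u≡v x = begin
      linComb F a' u x                            ≡⟨ linComb-+ a (λ l → g * c l) u x ⟩
      linComb F a u x + linComb F (λ l → g * c l) u x ≡⟨ cong₂ _+_ (au≡v x) (linComb-* g c u x) ⟩
      v x + g * linComb F c u x                   ≡⟨ cong (λ s → v x + g * s) (cu≡0 x) ⟩
      v x + g * 0#                                ≡⟨ cong (v x +_) (zeroʳ g) ⟩
      v x + 0#                                    ≡⟨ +-identityʳ (v x) ⟩
      v x                                         ∎
      where open ≡-Reasoning
    a'j≡0 : a' j ≡ 0#
    a'j≡0 = begin
      a j + - (a j * γ) * c j
        ≡⟨ cong (a j +_) (-‿distribˡ-* (a j * γ) (c j)) ⟨
      a j + - (a j * γ * c j)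
        ≡⟨ cong (λ s → a j + - s) (trans (*-assoc (a j) γ (c j)) (cong (a j *_) (*-comm γ (c j)))) ⟩
      a j + - (a j * (c j * γ))
        ≡⟨ cong (λ s → a j + - (a j * s)) cjγ≡1 ⟩
      a j + - (a j * 1#)
        ≡⟨ cong (λ s → a j + - s) (*-identityʳ (a j)) ⟩
      a j + - a j
        ≡⟨ -‿inverseʳ (a j) ⟩
      0#                         ∎
      where open ≡-Reasoning

  dot≡0∧removeAt≡0⇒≡0 : ∀ {k} (h y : V (suc k)) p → h p ≢ 0# → dot F h y ≡ 0# →
    (∀ x → removeAt y p x ≡ 0#) → ∀ x → y x ≡ 0#
  dot≡0∧removeAt≡0⇒≡0 h y p hp≢0 hy≡0 y≡0-off-p x with p Fin.≟ x
  ... | no p≢x = trans (cong y (sym (Fin.punchIn-punchOut p≢x))) (y≡0-off-p (punchOut p≢x))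
  ... | yes refl = x≢0∧x*y≡0⇒y≡0 hp≢0
    (trans (sym (sum-single (λ i → h i * y i) p (λ i → trans (cong (h (punchIn p i) *_) (y≡0-off-p i)) (zeroʳ _))))
           (trans (sym (dot≡sum h y)) hy≡0))

  Span : ∀ {k} → (V k → Set) → V k → Set
  Span = InSpan F (λ _ → ⊤)

  InSpan-mono : ∀ {k} {K K' : Pred F} {P P' : V k → Set} → (∀ {x} → K x → K' x) → (∀ {u} → P u → P' u) →
    ∀ {v} → InSpan F K P v → InSpan F K' P' v
  InSpan-mono K⊆K' P⊆P' (n , a , u , Ka , Pu , au≡v) = n , a , u , K⊆K' ∘ Ka , P⊆P' ∘ Pu , au≡v

  InSpan-resp : ∀ {k} {K : Pred F} {P : V k → Set} {v w : V k} → (∀ x → v x ≡ w x) → InSpan F K P v → InSpan F K P w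
  InSpan-resp v≡w (n , a , u , Ka , Pu , au≡v) = n , a , u , Ka , Pu , λ x → trans (au≡v x) (v≡w x)

  span-linComb : ∀ {k N} {P : V k → Set} (β : Fin N → Carrier) (g : Fin N → V k) →
    (∀ i → Span P (g i)) → Span P (linComb F β g)
  span-linComb {N = zero} β g _ = 0 , (λ ()) , (λ ()) , (λ ()) , (λ ()) , λ _ → refl
  span-linComb {N = suc N} {P} β g g∈span with g∈span zero | span-linComb {P = P} (β ∘ suc) (g ∘ suc) (g∈span ∘ suc)
  ... | n , a , u , _ , Pu , au≡g₀ | n' , a' , u' , _ , Pu' , a'u'≡rest =
    n ℕ.+ n' , (λ l → β zero * a l) ++ a' , u ++ u' , (λ _ → tt) , ++-all {P = P} u u' Pu Pu' , λ x →
      trans (linComb-++ (λ l → β zero * a l) u a' u' x)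
            (cong₂ _+_ (trans (linComb-* (β zero) a u x) (cong (β zero *_) (au≡g₀ x))) (a'u'≡rest x))

  linComb-shear : ∀ {k r} (c β : Fin r → Carrier) (u : Fin (suc r) → V k) p x →
    linComb F c (λ i y → u (punchIn p i) y + β i * u p y) x ≡ linComb F (insertAt c p (sum (λ i → c i * β i))) u x
  linComb-shear {r = r} c β u p x = begin
    linComb F c (λ i y → u (punchIn p i) y + β i * u p y) x
      ≡⟨ linComb-coordinate c _ x ⟩
    sum (λ i → c i * (u (punchIn p i) x + β i * u p x))
      ≡⟨ sum-cong-≗ (λ i → distribˡ (c i) _ _) ⟩
    sum (λ i → c i * u (punchIn p i) x + c i * (β i * u p x))
      ≡⟨ ∑-distrib-+ {r} _ _ ⟩
    sum rest + sum (λ i → c i * (β i * u p x))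
      ≡⟨ cong (sum rest +_) (sum-cong-≗ (λ i → *-assoc (c i) (β i) (u p x))) ⟨
    sum rest + sum (λ i → c i * β i * u p x)
      ≡⟨ cong (sum rest +_) (*-distribʳ-sum {r} (u p x) _) ⟨
    sum rest + μ * u p x
      ≡⟨ +-comm _ _ ⟩
    μ * u p x + sum rest
      ≡⟨ cong₂ _+_ (cong (_* u p x) (insertAt-lookup c p μ))
        (sum-cong-≗ (λ i → cong (_* u (punchIn p i) x) (insertAt-punchIn c p μ i))) ⟨
    t p + sum (removeAt t p)
      ≡⟨ sum-remove t ⟨
    sum t
      ≡⟨ linComb-coordinate (insertAt c p μ) u x ⟨
    linComb F (insertAt c p μ) u x                            ∎
    where
    open ≡-Reasoning
    μ : Carrier
    μ = sum (λ i → c i * β i)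
    t : Fin (suc r) → Carrier
    t l = insertAt c p μ l * u l x
    rest : Fin r → Carrier
    rest i = c i * u (punchIn p i) x

  δ : ∀ {k} → Fin k → V k
  δ i x with i Fin.≟ x
  ... | yes _ = 1#
  ... | no _ = 0#

  δ-diag : ∀ {k} (i : Fin k) → δ i i ≡ 1#
  δ-diag i with i Fin.≟ i
  ... | yes _ = refl
  ... | no i≢i = contradiction refl i≢i

  δ-off : ∀ {k} {i j : Fin k} → i ≢ j → δ i j ≡ 0#
  δ-off {i = i} {j} i≢j with i Fin.≟ j
  ... | yes i≡j = contradiction i≡j i≢j
  ... | no _ = refl

  sum-*δ : ∀ {k} (f : Fin k → Carrier) i → sum (λ x → f x * δ i x) ≡ f i
  sum-*δ {suc k} f i =
    trans (sum-single (λ x → f x * δ i x) i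
                      (λ x → trans (cong (f (punchIn i x) *_) (δ-off (Fin.punchInᵢ≢i i x ∘ sym))) (zeroʳ _)))
          (trans (cong (f i *_) (δ-diag i)) (*-identityʳ (f i)))

  sum-δ* : ∀ {k} (f : Fin k → Carrier) x → sum (λ i → f i * δ i x) ≡ f x
  sum-δ* {suc k} f x =
    trans (sum-single (λ i → f i * δ i x) x
                      (λ i → trans (cong (f (punchIn x i) *_) (δ-off (Fin.punchInᵢ≢i x i))) (zeroʳ _)))
          (trans (cong (f x *_) (δ-diag x)) (*-identityʳ (f x)))

  kernelVector : ∀ {k} → V k → Fin k → Fin k → V k
  kernelVector h p i x = h p * δ i x + - h i * δ p x

  dot-kernelVector : ∀ {k} (h : V k) p i → dot F h (kernelVector h p i) ≡ 0#
  dot-kernelVector {k} h p i = begin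
    dot F h (kernelVector h p i)
      ≡⟨ dot≡sum h _ ⟩
    sum (λ x → h x * (h p * δ i x + - h i * δ p x))
      ≡⟨ sum-cong-≗ expand ⟩
    sum (λ x → h p * (h x * δ i x) + - h i * (h x * δ p x))
      ≡⟨ sum-linear (h p) (- h i) (λ x → h x * δ i x) (λ x → h x * δ p x) ⟩
    h p * sum (λ x → h x * δ i x) + - h i * sum (λ x → h x * δ p x)
      ≡⟨ cong₂ (λ s t → h p * s + - h i * t) (sum-*δ h i) (sum-*δ h p) ⟩
    h p * h i + - h i * h p
      ≡⟨ cong (h p * h i +_) (trans (sym (-‿distribˡ-* (h i) (h p))) (cong -_ (*-comm (h i) (h p)))) ⟩
    h p * h i + - (h p * h i)
      ≡⟨ -‿inverseʳ (h p * h i) ⟩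
    0#                                                             ∎
    where
    open ≡-Reasoning
    expand : ∀ x → h x * (h p * δ i x + - h i * δ p x) ≡ h p * (h x * δ i x) + - h i * (h x * δ p x)
    expand x = trans (distribˡ (h x) _ _) (cong₂ _+_ (x∙yz≈y∙xz (h x) (h p) (δ i x)) (x∙yz≈y∙xz (h x) (- h i) (δ p x)))

  linComb-kernelVector : ∀ {k} (h v : V k) p → dot F h v ≡ 0# → ∀ x → linComb F v (kernelVector h p) x ≡ h p * v x
  linComb-kernelVector {k} h v p h⊥v x = begin
    linComb F v (kernelVector h p) x
      ≡⟨ linComb-coordinate v _ x ⟩
    sum (λ i → v i * (h p * δ i x + - h i * δ p x))
      ≡⟨ sum-cong-≗ expand ⟩
    sum (λ i → h p * (v i * δ i x) + - δ p x * (h i * v i))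
      ≡⟨ sum-linear (h p) (- δ p x) (λ i → v i * δ i x) (λ i → h i * v i) ⟩
    h p * sum (λ i → v i * δ i x) + - δ p x * sum (λ i → h i * v i)
      ≡⟨ cong₂ (λ s t → h p * s + - δ p x * t) (sum-δ* v x) (trans (sym (dot≡sum h v)) h⊥v) ⟩
    h p * v x + - δ p x * 0#
      ≡⟨ cong (h p * v x +_) (zeroʳ (- δ p x)) ⟩
    h p * v x + 0#
      ≡⟨ +-identityʳ (h p * v x) ⟩
    h p * v x                                                       ∎
    where
    open ≡-Reasoning
    expand : ∀ i → v i * (h p * δ i x + - h i * δ p x) ≡ h p * (v i * δ i x) + - δ p x * (h i * v i)
    expand i = trans (distribˡ (v i) _ _) (cong₂ _+_ (x∙yz≈y∙xz (v i) (h p) (δ i x)) (x*[-y*z]≡-z*[y*x] (v i) (h i) (δ p x)))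

  CombinationOfAtMost : ∀ {k} → (V k → Set) → ℕ → V k → Set
  CombinationOfAtMost {k} P n v = ∃ λ r → r ℕ.≤ n × ∃ λ (a : Fin r → Carrier) → ∃ λ (u : Fin r → V k) →
    (∀ j → P (u j)) × (∀ x → linComb F a u x ≡ v x)

  CombinationOfAtMost-mono : ∀ {k n} {P Q : V k → Set} → (∀ {u} → P u → Q u) → ∀ {v} →
    CombinationOfAtMost P n v → CombinationOfAtMost Q n v
  CombinationOfAtMost-mono P⊆Q (r , r≤n , a , u , Pu , au≡v) = r , r≤n , a , u , P⊆Q ∘ Pu , au≡v

module Subfield (F : Field) (E : Pred F) (E-subfield : IsSubfield F E) (_≟_ : DecidableEquality (Field.Carrier F)) where
  open Field F
  open Linear F
  open IsSubfield E-subfield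

  sum-closed : ∀ {n} (f : Fin n → Carrier) → (∀ i → E (f i)) → E (sum f)
  sum-closed {zero} f f∈E = 0∈
  sum-closed {suc n} f f∈E = +∈ (f∈E zero) (sum-closed (f ∘ suc) (f∈E ∘ suc))

  Dependent : ∀ {n r} → (Fin r → V n) → Set
  Dependent {r = r} u = ∃ λ (c : Fin r → Carrier) →
    InSub F E c × (∃ λ j → c j ≢ 0#) × (∀ x → linComb F c u x ≡ 0#)

  dependent-tail : ∀ {n r} (u : Fin r → V (suc n)) → (∀ l → u l zero ≡ 0#) → Dependent (tail ∘ u) → Dependent u
  dependent-tail u u₀≡0 (c , c∈E , c≢0 , cu'≡0) = c , c∈E , c≢0 , λ where
    zero → trans (linComb-coordinate c u zero) (sum-zero (λ l → trans (cong (c l *_) (u₀≡0 l)) (zeroʳ (c l))))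
    (suc x) → trans (sym (linComb-∘ c u suc x)) (cu'≡0 x)

  module Elimination {n r} (u : Fin (suc r) → V (suc n)) (u∈E : ∀ l → InSub F E (u l))
                     (p : Fin (suc r)) (ι : Carrier) (u₀ι≡1 : u p zero * ι ≡ 1#) where
    β : Fin r → Carrier
    β i = - (u (punchIn p i) zero * ι)

    w : Fin r → V (suc n)
    w i y = u (punchIn p i) y + β i * u p y

    β∈E : ∀ i → E (β i)
    β∈E i = -∈ (*∈ (u∈E (punchIn p i) zero) (⁻¹∈ (u∈E p zero) u₀ι≡1))

    w∈E : ∀ i → InSub F E (w i)
    w∈E i y = +∈ (u∈E (punchIn p i) y) (*∈ (β∈E i) (u∈E p y))

    w₀≡0 : ∀ i → w i zero ≡ 0#
    w₀≡0 i = begin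
      a + - (a * ι) * b    ≡⟨ cong (a +_) (-‿distribˡ-* (a * ι) b) ⟨
      a + - (a * ι * b)    ≡⟨ cong (λ s → a + - s) (trans (*-assoc a ι b) (cong (a *_) (*-comm ι b))) ⟩
      a + - (a * (b * ι))  ≡⟨ cong (λ s → a + - (a * s)) u₀ι≡1 ⟩
      a + - (a * 1#)       ≡⟨ cong (λ s → a + - s) (*-identityʳ a) ⟩
      a + - a              ≡⟨ -‿inverseʳ a ⟩
      0#                   ∎
      where
      open ≡-Reasoning
      a = u (punchIn p i) zero
      b = u p zero

    dependent-lift : Dependent w → Dependent u
    dependent-lift (c , c∈E , (j , cj≢0) , cw≡0) =
      insertAt c p μ ,
      insertAt-all {P = E} c p (sum-closed _ (λ i → *∈ (c∈E i) (β∈E i))) c∈E ,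
      (punchIn p j , λ eq → cj≢0 (trans (sym (insertAt-punchIn c p μ j)) eq)) ,
      λ x → trans (sym (linComb-shear c β u p x)) (cw≡0 x)
      where
      μ : Carrier
      μ = sum (λ i → c i * β i)

  dependent : ∀ n r → n ℕ.< r → (u : Fin r → V n) → (∀ l → InSub F E (u l)) → Dependent u
  dependent zero (suc r) _ u _ = (λ _ → 1#) , (λ _ → 1∈) , (zero , λ 1≡0 → 0≢1 (sym 1≡0)) , λ ()
  dependent (suc n) (suc r) (s≤s n<r) u u∈E with Fin.any? (λ l → ¬? (u l zero ≟ 0#))
  ... | no no-pivot = dependent-tail u u₀≡0 (dependent n (suc r) (ℕ.m<n⇒m<1+n n<r) (tail ∘ u) (λ l → u∈E l ∘ suc))
    where
    u₀≡0 : ∀ l → u l zero ≡ 0#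
    u₀≡0 l = decidable-stable (u l zero ≟ 0#) (λ u₀≢0 → no-pivot (l , u₀≢0))
  ... | yes (p , up₀≢0) with inverse (u p zero) up₀≢0
  ... | ι , u₀ι≡1 = dependent-lift (dependent-tail w w₀≡0 (dependent n r n<r (tail ∘ w) (λ i → w∈E i ∘ suc)))
    where open Elimination u u∈E p ι u₀ι≡1

  δ∈E : ∀ {k} (i : Fin k) → InSub F E (δ i)
  δ∈E i x with i Fin.≟ x
  ... | yes _ = 1∈
  ... | no _ = 0∈

  kernelVector∈E : ∀ {k} (h : V k) p i → InSub F E h → InSub F E (kernelVector h p i)
  kernelVector∈E h p i h∈E x = +∈ (*∈ (h∈E p) (δ∈E i x)) (*∈ (-∈ (h∈E i)) (δ∈E p x))

  span-hyperplane : ∀ {k} {P : V k → Set} (h : V k) p → InSub F E h → h p ≢ 0# →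
    (∀ w → InSub F E w → dot F h w ≡ 0# → InSpan F E P w) → ∀ v → dot F h v ≡ 0# → Span P v
  span-hyperplane {P = P} h p h∈E hp≢0 kernel⊆span v h⊥v with inverse (h p) hp≢0
  ... | ι , hpι≡1 = InSpan-resp {P = P} combination≡v (span-linComb {P = P} (λ i → ι * v i) (kernelVector h p) kernelVector∈span)
    where
    kernelVector∈span : ∀ i → Span P (kernelVector h p i)
    kernelVector∈span i = InSpan-mono {K = E} {P = P} (λ _ → tt) (λ Pu → Pu)
      (kernel⊆span _ (kernelVector∈E h p i h∈E) (dot-kernelVector h p i))
    combination≡v : ∀ x → linComb F (λ i → ι * v i) (kernelVector h p) x ≡ v x
    combination≡v x = begin
      linComb F (λ i → ι * v i) (kernelVector h p) x  ≡⟨ linComb-* ι v (kernelVector h p) x ⟩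
      ι * linComb F v (kernelVector h p) x            ≡⟨ cong (ι *_) (linComb-kernelVector h v p h⊥v x) ⟩
      ι * (h p * v x)                                 ≡⟨ *-assoc ι (h p) (v x) ⟨
      ι * h p * v x                                   ≡⟨ cong (_* v x) (trans (*-comm ι (h p)) hpι≡1) ⟩
      1# * v x                                        ≡⟨ *-identityˡ (v x) ⟩
      v x                                             ∎
      where open ≡-Reasoning

  dependent-in-hyperplane : ∀ {k N} (h : V (suc k)) p → h p ≢ 0# → k ℕ.< N → (u : Fin N → V (suc k)) →
    (∀ l → InSub F E (u l)) → (∀ l → dot F h (u l) ≡ 0#) → Dependent u
  dependent-in-hyperplane {k} {N} h p hp≢0 k<N u u∈E h⊥u
    with dependent k N k<N (λ l → u l ∘ punchIn p) (λ l → u∈E l ∘ punchIn p)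
  ... | c , c∈E , c≢0 , cu'≡0 = c , c∈E , c≢0 , dot≡0∧removeAt≡0⇒≡0 h (linComb F c u) p hp≢0 h⊥cu cu≡0-off-p
    where
    h⊥cu : dot F h (linComb F c u) ≡ 0#
    h⊥cu = trans (dot-linComb h c u) (sum-zero (λ l → trans (cong (c l *_) (h⊥u l)) (zeroʳ (c l))))
    cu≡0-off-p : ∀ x → linComb F c u (punchIn p x) ≡ 0#
    cu≡0-off-p x = trans (sym (linComb-∘ c u (punchIn p) x)) (cu'≡0 x)

  shorten-in-hyperplane : ∀ {k N} (h : V (suc k)) p → h p ≢ 0# → {P : V (suc k) → Set} →
    (∀ {u} → P u → InSub F E u) → (∀ {u} → P u → dot F h u ≡ 0#) →
    ∀ {v} (a : Fin N → Carrier) (u : Fin N → V (suc k)) → (∀ l → P (u l)) → (∀ x → linComb F a u x ≡ v x) →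
    CombinationOfAtMost P k v
  shorten-in-hyperplane {N = zero} h p hp≢0 P⊆E P⊥h a u Pu au≡v = 0 , z≤n , a , u , Pu , au≡v
  shorten-in-hyperplane {k} {suc N} h p hp≢0 P⊆E P⊥h {v} a u Pu au≡v with suc N ℕ.≤? k
  ... | yes N<k = suc N , N<k , a , u , Pu , au≡v
  ... | no N≮k with dependent-in-hyperplane h p hp≢0 (ℕ.≰⇒> N≮k) u (P⊆E ∘ Pu) (P⊥h ∘ Pu)
  ... | c , _ , (j , cj≢0) , cu≡0 with removeAt-redundant c a u v j cj≢0 cu≡0 au≡v
  ... | a' , a'u'≡v = shorten-in-hyperplane h p hp≢0 P⊆E P⊥h a' (removeAt u j) (Pu ∘ punchIn j) a'u'≡v

module Counting (F : Field) (E : Pred F) (E-subfield : IsSubfield F E) {Q M : ℕ}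
                (enumE : Enumeration E Q) (enumF : Enumeration {Field.Carrier F} (λ _ → ⊤) M) where
  open Field F
  open Linear F
  open IsSubfield E-subfield
  open Tuples enumE
  open Enumeration enumF using (elem; elem-injective; index; elem-index)
  open AdditiveGroupProperties (CommutativeRing.+-group commutativeRing) using (x∙y⁻¹≈ε⇒x≈y; inverseʳ-unique)

  _≟_ : DecidableEquality Carrier
  _≟_ = decidableEquality enumF

  open Subfield F E E-subfield _≟_

  annihilator-exists : ∀ {k} → M ℕ.< Q ℕ.^ k → (v : V k) →
    ∃ λ h → InSub F E h × (∃ λ p → h p ≢ 0#) × dot F h v ≡ 0#
  annihilator-exists {k} M<Qᵏ v with Fin.pigeonhole M<Qᵏ (λ t → index {dot F (tuple t) v} tt)
  ... | t , t' , t<t' , same-index = h , h∈E , (p , hp≢0) , h⊥v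
    where
    h : V k
    h x = tuple t x + - tuple t' x
    h∈E : InSub F E h
    h∈E x = +∈ (tuple∈ t x) (-∈ (tuple∈ t' x))
    same-value : dot F (tuple t) v ≡ dot F (tuple t') v
    same-value = trans (sym (elem-index tt)) (trans (cong elem same-index) (elem-index tt))
    differ : ∃ λ p → tuple t p ≢ tuple t' p
    differ = Fin.¬∀⟶∃¬ k _ (λ x → tuple t x ≟ tuple t' x) (λ t≗t' → Fin.<⇒≢ t<t' (tuple-injective t t' t≗t'))
    p : Fin k
    p = proj₁ differ
    hp≢0 : h p ≢ 0#
    hp≢0 hp≡0 = proj₂ differ (x∙y⁻¹≈ε⇒x≈y _ _ hp≡0)
    h⊥v : dot F h v ≡ 0#
    h⊥v = trans (dot-difference (tuple t) (tuple t') v)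
                (trans (cong (λ s → s + - dot F (tuple t') v) same-value) (-‿inverseʳ _))

  Independent : ∀ {e} → V e → Set
  Independent {e} b = ∀ (c : V e) → InSub F E c → dot F c b ≡ 0# → ∀ i → c i ≡ 0#

  OutsideSpan : ∀ {e} → V e → Carrier → Set
  OutsideSpan b y = ∀ c → InSub F E c → dot F c b ≢ y

  outside-span-exists : ∀ {e} → Q ℕ.^ e ℕ.< M → (b : V e) → ∃ (OutsideSpan b)
  outside-span-exists {e} Qᵉ<M b = elem z , outside
    where
    Spanned : Fin M → Set
    Spanned z = ∃ λ t → dot F (tuple {e} t) b ≡ elem z
    not-all-spanned : ¬ (∀ z → Spanned z)
    not-all-spanned spanned with Fin.pigeonhole Qᵉ<M (proj₁ ∘ spanned)
    ... | z , z' , z<z' , same-t = Fin.<⇒≢ z<z' (elem-injective z z'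
      (trans (sym (proj₂ (spanned z))) (trans (cong (λ t → dot F (tuple t) b) same-t) (proj₂ (spanned z')))))
    unspanned : ∃ λ z → ¬ Spanned z
    unspanned = Fin.¬∀⟶∃¬ M Spanned (λ z → Fin.any? (λ t → dot F (tuple t) b ≟ elem z)) not-all-spanned
    z : Fin M
    z = proj₁ unspanned
    outside : OutsideSpan b (elem z)
    outside c c∈E cb≡z with tuple-complete c c∈E
    ... | t , t≗c = proj₂ unspanned (t , trans (dot-cong t≗c (λ _ → refl)) cb≡z)

  independent-∷ : ∀ {e} {b : V e} {y} → Independent b → OutsideSpan b y → Independent (y Vector.∷ b)
  independent-∷ {b = b} {y} b-indep y-outside c c∈E c⊥yb with c zero ≟ 0#
  ... | yes c₀≡0 = λ { zero → c₀≡0 ; (suc i) → b-indep (tail c) (c∈E ∘ suc) tail⊥b i }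
    where
    tail⊥b : dot F (tail c) b ≡ 0#
    tail⊥b = begin
      dot F (tail c) b                 ≡⟨ +-identityˡ _ ⟨
      0# + dot F (tail c) b            ≡⟨ cong (_+ dot F (tail c) b) (trans (cong (_* y) c₀≡0) (zeroˡ y)) ⟨
      c zero * y + dot F (tail c) b    ≡⟨ c⊥yb ⟩
      0#                               ∎
      where open ≡-Reasoning
  ... | no c₀≢0 with inverse (c zero) c₀≢0
  ... | ι , c₀ι≡1 = contradiction y-spanned (y-outside (λ i → - ι * c (suc i)) (λ i → *∈ (-∈ ι∈E) (c∈E (suc i))))
    where
    ι∈E : E ι
    ι∈E = ⁻¹∈ (c∈E zero) c₀ι≡1
    y-spanned : dot F (λ i → - ι * c (suc i)) b ≡ y
    y-spanned = begin
      dot F (λ i → - ι * c (suc i)) b  ≡⟨ dot-*ˡ (- ι) (tail c) b ⟩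
      - ι * dot F (tail c) b           ≡⟨ cong (- ι *_) (inverseʳ-unique (c zero * y) _ c⊥yb) ⟩
      - ι * - (c zero * y)             ≡⟨ -‿distribˡ-* ι _ ⟨
      - (ι * - (c zero * y))           ≡⟨ cong -_ (-‿distribʳ-* ι _) ⟨
      - - (ι * (c zero * y))           ≡⟨ -‿involutive _ ⟩
      ι * (c zero * y)                 ≡⟨ *-assoc ι (c zero) y ⟨
      ι * c zero * y                   ≡⟨ cong (_* y) (trans (*-comm ι (c zero)) c₀ι≡1) ⟩
      1# * y                           ≡⟨ *-identityˡ y ⟩
      y                                ∎
      where open ≡-Reasoning

  independent-exists : ∀ d → (∀ {e} → e ℕ.< d → Q ℕ.^ e ℕ.< M) → ∃ λ (b : V d) → Independent b
  independent-exists zero _ = (λ ()) , λ _ _ _ ()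
  independent-exists (suc d) small with independent-exists d (small ∘ ℕ.m<n⇒m<1+n)
  ... | b , b-indep with outside-span-exists (small (ℕ.n<1+n d)) b
  ... | y , y-outside = y Vector.∷ b , independent-∷ b-indep y-outside

  no-short-combination : ∀ {n r} {b : V (suc n)} → Independent b → r ℕ.≤ n →
    (a : Fin r → Carrier) (u : Fin r → V (suc n)) → (∀ l → InSub F E (u l)) → ¬ (∀ x → linComb F a u x ≡ b x)
  no-short-combination {n} {r} {b} b-indep r≤n a u u∈E au≡b
    with dependent r (suc n) (s≤s r≤n) (λ i l → u l i) (λ i l → u∈E l i)
  ... | c , c∈E , (j , cj≢0) , c-rows≡0 = cj≢0 (b-indep c c∈E c⊥b j)
    where
    c⊥u : ∀ l → dot F c (u l) ≡ 0#
    c⊥u l = trans (dot≡sum c (u l)) (trans (sym (linComb-coordinate c (λ i l → u l i) l)) (c-rows≡0 l))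
    c⊥b : dot F c b ≡ 0#
    c⊥b = begin
      dot F c b                         ≡⟨ dot-cong {a = c} (λ _ → refl) (λ x → sym (au≡b x)) ⟩
      dot F c (linComb F a u)           ≡⟨ dot-linComb c a u ⟩
      sum (λ l → a l * dot F c (u l))   ≡⟨ sum-zero (λ l → trans (cong (a l *_) (c⊥u l)) (zeroʳ (a l))) ⟩
      0#                                ∎
      where open ≡-Reasoning

  union⊆E : ∀ {K k t} {U : Fin t → V k → Set} → IsSystem F K E U → ∀ {u} → Union F U u → InSub F E u
  union⊆E system (i , u∈Uᵢ) = IsSubspaceOver.inE (IsSystem.subspaces system i) u∈Uᵢ

  HyperplaneSection : ∀ {k t} → (Fin t → V k → Set) → V k → V k → Set
  HyperplaneSection U h u = Union F U u × ¬ (∀ x → u x ≡ 0#) × dot F h u ≡ 0#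

  span-hyperplane-sections : ∀ {K k t} {U : Fin t → V k → Set} → IsCutting F K E U → M ℕ.< Q ℕ.^ k → ∀ v →
    ∃ λ h → ∃ λ p → h p ≢ 0# × Span (HyperplaneSection U h) v
  span-hyperplane-sections {U = U} (_ , cuts) M<Qᵏ v with annihilator-exists M<Qᵏ v
  ... | h , h∈E , (p , hp≢0) , h⊥v =
    h , p , hp≢0 , span-hyperplane {P = HyperplaneSection U h} h p h∈E hp≢0 (cuts h h∈E (λ h≈0 → hp≢0 (h≈0 p))) v h⊥v

  spans-all : ∀ {K k t} {U : Fin t → V k → Set} → IsCutting F K E U → M ℕ.< Q ℕ.^ k → ∀ v → Span (Union F U) v
  spans-all {U = U} cutting M<Qᵏ v = InSpan-mono {P = HyperplaneSection U (proj₁ sections)} {P' = Union F U}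
    (λ x → x) proj₁ (proj₂ (proj₂ (proj₂ sections)))
    where
    sections : ∃ λ h → ∃ λ p → h p ≢ 0# × Span (HyperplaneSection U h) v
    sections = span-hyperplane-sections cutting M<Qᵏ v

  covered : ∀ {K k t} {U : Fin t → V (suc k) → Set} → IsCutting F K E U → M ℕ.< Q ℕ.^ suc k → CoveredBy F U k
  covered {k = k} {U = U} cutting M<Qᵏ v _ = shorten (span-hyperplane-sections cutting M<Qᵏ v)
    where
    UnionNonzero : V (suc k) → Set
    UnionNonzero u = Union F U u × ¬ (∀ x → u x ≡ 0#)
    shorten : (∃ λ h → ∃ λ p → h p ≢ 0# × Span (HyperplaneSection U h) v) →
      CombinationOfAtMost UnionNonzero k v
    shorten (h , p , hp≢0 , (N , a , u , _ , u∈sections , au≡v)) =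
      CombinationOfAtMost-mono {P = HyperplaneSection U h} {Q = UnionNonzero} (λ (u∈U , u≢0 , _) → u∈U , u≢0)
        (shorten-in-hyperplane h p hp≢0 {P = HyperplaneSection U h}
          (union⊆E (proj₁ cutting) ∘ proj₁) (proj₂ ∘ proj₂) a u u∈sections au≡v)

  not-covered : ∀ {K n t} {U : Fin t → V (suc (suc n)) → Set} → IsSystem F K E U →
    (∀ {e} → e ℕ.< suc n → Q ℕ.^ e ℕ.< M) → ¬ CoveredBy F U n
  not-covered {n = n} system small cover with independent-exists (suc n) small
  ... | b , b-indep with cover (1# Vector.∷ b) (λ v≈0 → 0≢1 (sym (v≈0 zero)))
  ... | r , r≤n , a , u , u∈U , au≡v =
    no-short-combination b-indep r≤n a (tail ∘ u) (λ l → union⊆E system (proj₁ (u∈U l)) ∘ suc)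
      (λ x → trans (linComb-∘ a u suc x) (au≡v (suc x)))

subspace-of-ambient : ∀ (F : Field) {K E : Pred F} {k} {W : Vect F k → Set} →
  IsSubspaceOver F K E W → IsSubspaceOver F K (λ _ → ⊤) W
subspace-of-ambient F W-subspace = record { IsSubspaceOver W-subspace ; inE = λ _ _ → tt }

open import Data.Nat using (_≤_; _<_; _∸_; _*_; _^_)

prime-power>1 : ∀ {q} → IsPrimePower q → 1 < q
prime-power>1 (p , e , p-prime , 1≤e , refl) = ℕ.^-monoʳ-< p (nonTrivial⇒n>1 p {{prime⇒nonTrivial p-prime}}) 1≤e

^-*-monoʳ-< : ∀ {q m a b} → 1 < q → 1 ≤ m → a < b → q ^ (m * a) < q ^ (m * b)
^-*-monoʳ-< {q} {suc m} 1<q _ a<b = ℕ.^-monoʳ-< q 1<q (ℕ.*-monoʳ-< (suc m) a<b)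

theorem4p6 : (q m t k : ℕ) → IsPrimePower q → 1 ≤ m → 1 ≤ t → 2 ≤ k →
    (L : Field) (Fq Fqm : Pred L) →
    IsSubfield L Fq → HasSize L Fq q →
    IsSubfield L Fqm → HasSize L Fqm (q ^ m) → (∀ x → Fq x → Fqm x) →
    HasSize L (λ _ → ⊤) (q ^ (m * (k ∸ 1))) →
    (U : Fin t → Vect L k → Set) →
    IsCutting L Fq Fqm U →
    IsSumRankSaturating L Fq U (k ∸ 1)
theorem4p6 q m t (suc zero) _ _ _ (s≤s ())
theorem4p6 q m t (suc (suc n)) q-prime-power 1≤m _ _ L Fq Fqm _ _ Fqm-subfield Fqm-size _ L-size U cutting =
  system , covered cutting M<Qᵏ , not-covered (proj₁ cutting) Qᵉ<M
  where
  open Counting L Fqm Fqm-subfield (enumeration L Fqm-size) (enumeration L L-size)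
  1<q : 1 < q
  1<q = prime-power>1 q-prime-power
  M<Qᵏ : q ^ (m * suc n) < (q ^ m) ^ suc (suc n)
  M<Qᵏ = subst (q ^ (m * suc n) <_) (sym (ℕ.^-*-assoc q m (suc (suc n)))) (^-*-monoʳ-< 1<q 1≤m (ℕ.n<1+n (suc n)))
  Qᵉ<M : ∀ {e} → e < suc n → (q ^ m) ^ e < q ^ (m * suc n)
  Qᵉ<M {e} e<1+n = subst (_< q ^ (m * suc n)) (sym (ℕ.^-*-assoc q m e)) (^-*-monoʳ-< 1<q 1≤m e<1+n)
  system : IsSystem L Fq (λ _ → ⊤) U
  system = record
    { subspaces = λ i → subspace-of-ambient L (IsSystem.subspaces (proj₁ cutting) i)
    ; spans = λ v _ → spans-all cutting M<Qᵏ v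
    }
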